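{- Let $\langle X,\tau^0,\tau^1\rangle$ be any bitopological space. Then the formulas J1: $\Box(p\to q)\to(p\rhd q)$; J2: $(p\rhd q)\land(q\rhd r)\to(p\rhd r)$; J3: $(p\rhd r)\land(q\rhd r)\to((p\lor q)\rhd r)$; J4: $(p\rhd q)\to(\Diamond p\to\Diamond q)$ are valid in $\langle X,\tau^0,\tau^1\rangle$.
   Context: Formulas are in the language with propositional variables, $\top,\bot$, $\neg,\land,\lor,\to$, unary $\Box,\Diamond$ and binary $\rhd$. For a topology $\tau$ on $X$ and $Y\subseteq X$, $d_\tau(Y)=\{x\in X: \text{every } U\in\tau \text{ with } x\in U \text{ contains some } y\neq x,\ y\in Y\}$ and $cd_\tau(Y)=X\setminus d_\tau(X\setminus Y)$. A bitopological space is $\langle X,\tau^0,\tau^1\rangle$ with $X\neq\varnothing$ and $\tau^0,\tau^1$ topologies on $X$. $e_{\tau^0,\tau^1}(Y,Z)=\{x\in X:\forall U\in\tau^1[x\in d_{\tau^0}(Y\cap U)\Rightarrow x\in d_{\tau^0}(Z\cap U)]\}$. A valuation $v$ maps formulas to subsets of $X$ with $v(\bot)=\varnothing$, $v(\top)=X$, $v(\neg\varphi)=X\setminus v(\varphi)$, $v(\varphi\land\psi)=v(\varphi)\cap v(\psi)$, $v(\varphi\lor\psi)=v(\varphi)\cup v(\psi)$, $v(\varphi\to\psi)=(X\setminus v(\varphi))\cup v(\psi)$, $v(\Box\varphi)=cd_{\tau^0}(v(\varphi))$, $v(\Diamond\varphi)=d_{\tau^0}(v(\varphi))$, $v(\varphi\rhd\psi)=e_{\tau^0,\tau^1}(v(\varphi),v(\psi))$.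 A formula is valid in the space if $v(\varphi)=X$ for every valuation $v$. -}

module Defs where

open import Level using (0ℓ)
open import Data.Nat using (ℕ)
open import Data.Product using (Σ; _×_; _,_)
open import Data.Sum using (_⊎_)
open import Data.Unit using (⊤)
open import Data.Empty using (⊥)
open import Relation.Nullary using (¬_)
open import Relation.Binary.PropositionalEquality using (_≡_)

Subset : Set → Set₁
Subset X = X → Set

-- A topology on X, presented (for predicativity) as a Set-indexed family of
-- open subsets ⟨ o ⟩, o : Opn, which contains X and ∅ and is closed (up to
-- pointwise equivalence) under binary intersections and Set-indexed unions.
_⇔ₛ_ : ∀ {X : Set} → Subset X → Subset X → Set
U ⇔ₛ V = ∀ x → (U x → V x) × (V x → U x)

record Topology (X : Set) : Set₁ where
  field
    Opn       : Set
    ⟨_⟩       : Opn → Subset X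
    open-full : Σ Opn λ o → ⟨ o ⟩ ⇔ₛ (λ _ → ⊤)
    open-empty : Σ Opn λ o → ⟨ o ⟩ ⇔ₛ (λ _ → ⊥)
    open-∩    : ∀ (o o' : Opn) → Σ Opn λ w → ⟨ w ⟩ ⇔ₛ (λ x → ⟨ o ⟩ x × ⟨ o' ⟩ x)
    open-⋃    : ∀ {I : Set} (f : I → Opn) →
                Σ Opn λ w → ⟨ w ⟩ ⇔ₛ (λ x → Σ I λ i → ⟨ f i ⟩ x)
open Topology public

d : ∀ {X : Set} → Topology X → Subset X → Subset X
d {X} τ Y x = ∀ (o : Opn τ) → ⟨ τ ⟩ o x →
              Σ X λ y → (¬ (y ≡ x)) × Y y × ⟨ τ ⟩ o y

cd : ∀ {X : Set} → Topology X → Subset X → Subset X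
cd τ Y x = ¬ d τ (λ z → ¬ Y z) x

record BiTop : Set₁ where
  field
    Carrier : Set
    point   : Carrier
    τ⁰      : Topology Carrier
    τ¹      : Topology Carrier
open BiTop public

e : ∀ {X : Set} → Topology X → Topology X → Subset X → Subset X → Subset X
e {X} t0 t1 Y Z x = ∀ (o : Opn t1) →
                    d t0 (λ z → Y z × ⟨ t1 ⟩ o z) x → d t0 (λ z → Z z × ⟨ t1 ⟩ o z) x

infixr 5 _⇒_
infixl 7 _∧_
infixl 6 _∨_
infix 8 _▷_
data Fm : Set where
  var : ℕ → Fm
  ⊤ᶠ ⊥ᶠ : Fm
  ¬ᶠ_ : Fm → Fm
  _∧_ _∨_ _⇒_ : Fm → Fm → Fm
  □ ◇ : Fm → Fm
  _▷_ : Fm → Fm → Fm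

⟦_⟧ : Fm → (B : BiTop) → (ℕ → Subset (Carrier B)) → Subset (Carrier B)
⟦ var n ⟧ B ρ x = ρ n x
⟦ ⊤ᶠ ⟧ B ρ x = ⊤
⟦ ⊥ᶠ ⟧ B ρ x = ⊥
⟦ ¬ᶠ φ ⟧ B ρ x = ¬ ⟦ φ ⟧ B ρ x
⟦ φ ∧ ψ ⟧ B ρ x = ⟦ φ ⟧ B ρ x × ⟦ ψ ⟧ B ρ x
⟦ φ ∨ ψ ⟧ B ρ x = ⟦ φ ⟧ B ρ x ⊎ ⟦ ψ ⟧ B ρ x
⟦ φ ⇒ ψ ⟧ B ρ x = (¬ ⟦ φ ⟧ B ρ x) ⊎ ⟦ ψ ⟧ B ρ x
⟦ □ φ ⟧ B ρ x = cd (τ⁰ B) (⟦ φ ⟧ B ρ) x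
⟦ ◇ φ ⟧ B ρ x = d (τ⁰ B) (⟦ φ ⟧ B ρ) x
⟦ φ ▷ ψ ⟧ B ρ x = e (τ⁰ B) (τ¹ B) (⟦ φ ⟧ B ρ) (⟦ ψ ⟧ B ρ) x

Valid : BiTop → Fm → Set₁
Valid B φ = ∀ (ρ : ℕ → Subset (Carrier B)) (x : Carrier B) → ⟦ φ ⟧ B ρ x

p q r : Fm
p = var 0
q = var 1
r = var 2

J1 J2 J3 J4 : Fm
J1 = □ (p ⇒ q) ⇒ (p ▷ q)
J2 = (p ▷ q) ∧ (q ▷ r) ⇒ (p ▷ r)
J3 = (p ▷ r) ∧ (q ▷ r) ⇒ ((p ∨ q) ▷ r)
J4 = (p ▷ q) ⇒ (◇ p ⇒ ◇ q)

{-# OPTIONS --safe #-}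
-- J2 is transitivity of implication under a fixed τ¹-open U. The others reduce
-- to three facts about the τ⁰-derived set: it is monotone (J4, taking U = X),
-- it distributes over binary unions (J3), and d Y ∩ cd W ⊆ d (Y ∩ W) (J1,
-- with W = ¬p ∨ q). The last two shrink an arbitrary neighbourhood by one
-- that witnesses the failure of d, and so use excluded middle.
module Submission where

open import Defs
open import Level using (0ℓ)
open import Data.Product using (_×_; Σ; _,_; proj₁; proj₂)
open import Data.Sum using (_⊎_; inj₁; inj₂; [_,_])
open import Data.Unit using (tt)
open import Relation.Nullary using (¬_; contradiction)
open import Relation.Nullary.Negation using (Stable)
open import Function using (case_of_)
open import Relation.Binary.PropositionalEquality using (_≡_)
open import Axiom.ExcludedMiddle using (ExcludedMiddle)
open import Axiom.DoubleNegationElimination using (em⇒dne)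

private
  variable
    X : Set
    Y Z W : Subset X

_⊆_ : Subset X → Subset X → Set
Y ⊆ Z = ∀ y → Y y → Z y

d-mono : (τ : Topology X) → Y ⊆ Z → d τ Y ⊆ d τ Z
d-mono τ Y⊆Z x dYx o x∈o with dYx o x∈o
... | y , y≢x , Yy , y∈o = y , y≢x , Y⊆Z y Yy , y∈o

∩-nbhd : (τ : Topology X) {o o′ : Opn τ} {x : X} → ⟨ τ ⟩ o x → ⟨ τ ⟩ o′ x →
         Σ (Opn τ) λ w → ⟨ τ ⟩ w x × (∀ y → ⟨ τ ⟩ w y → ⟨ τ ⟩ o y × ⟨ τ ⟩ o′ y)
∩-nbhd τ {o} {o′} {x} x∈o x∈o′ with open-∩ τ o o′
... | w , w⇔o∩o′ = w , proj₂ (w⇔o∩o′ x) (x∈o , x∈o′) , λ y → proj₁ (w⇔o∩o′ y)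

e-trans : (τ σ : Topology X) {x : X} → e τ σ Y Z x → e τ σ Z W x → e τ σ Y W x
e-trans τ σ eYZ eZW o dYo = eZW o (eYZ o dYo)

e⇒d⇒d : (τ σ : Topology X) {x : X} → e τ σ Y Z x → d τ Y x → d τ Z x
e⇒d⇒d τ σ {x} eYZ dYx with open-full σ
... | X′ , X′⇔X = d-mono τ (λ _ → proj₁) x
                    (eYZ X′ (d-mono τ (λ y Yy → Yy , proj₂ (X′⇔X y) tt) x dYx))

module Classical (em : ExcludedMiddle 0ℓ) where

  dne : {A : Set} → Stable A
  dne = em⇒dne em

  →⇒¬⊎ : {A B : Set} → (A → B) → ¬ A ⊎ B
  →⇒¬⊎ f = dne λ k → k (inj₁ λ a → k (inj₂ (f a)))

  ¬d⇒isolating-nbhd : (τ : Topology X) {x : X} → ¬ d τ Y x →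
    Σ (Opn τ) λ o → ⟨ τ ⟩ o x × ¬ (Σ X λ y → ¬ y ≡ x × Y y × ⟨ τ ⟩ o y)
  ¬d⇒isolating-nbhd τ ¬dYx = dne λ k → ¬dYx λ o x∈o → dne λ n → k (o , x∈o , n)

  d-∪ : (τ : Topology X) → d τ (λ z → Y z ⊎ Z z) ⊆ (λ x → d τ Y x ⊎ d τ Z x)
  d-∪ τ x dY∪Zx = dne λ k →
    let o , x∈o , o-avoids-Y = ¬d⇒isolating-nbhd τ (λ dY → k (inj₁ dY))
        o′ , x∈o′ , o′-avoids-Z = ¬d⇒isolating-nbhd τ (λ dZ → k (inj₂ dZ))
        w , x∈w , w⊆o∩o′ = ∩-nbhd τ x∈o x∈o′
    in case dY∪Zx w x∈w of λ where
         (y , y≢x , inj₁ Yy , y∈w) → o-avoids-Y (y , y≢x , Yy , proj₁ (w⊆o∩o′ y y∈w))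
         (y , y≢x , inj₂ Zy , y∈w) → o′-avoids-Z (y , y≢x , Zy , proj₂ (w⊆o∩o′ y y∈w))

  d-∩-cd : (τ : Topology X) {x : X} → d τ Y x → cd τ W x → d τ (λ z → Y z × W z) x
  d-∩-cd τ dYx cdWx o x∈o with ¬d⇒isolating-nbhd τ cdWx
  ... | o′ , x∈o′ , o′-avoids-¬W with ∩-nbhd τ x∈o x∈o′
  ... | w , x∈w , w⊆o∩o′ with dYx w x∈w
  ... | y , y≢x , Yy , y∈w =
    y , y≢x , (Yy , dne λ ¬Wy → o′-avoids-¬W (y , y≢x , ¬Wy , proj₂ (w⊆o∩o′ y y∈w)))
      , proj₁ (w⊆o∩o′ y y∈w)

  cd⇒e : (τ σ : Topology X) {x : X} → cd τ (λ z → ¬ Y z ⊎ Z z) x → e τ σ Y Z x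
  cd⇒e τ σ cdY⇒Z o dYo = d-mono τ Y∩U∩[Y⇒Z]⊆Z∩U _ (d-∩-cd τ dYo cdY⇒Z)
    where
    Y∩U∩[Y⇒Z]⊆Z∩U : (λ z → (Y z × ⟨ σ ⟩ o z) × (¬ Y z ⊎ Z z)) ⊆ (λ z → Z z × ⟨ σ ⟩ o z)
    Y∩U∩[Y⇒Z]⊆Z∩U z ((Yz , z∈o) , inj₁ ¬Yz) = contradiction Yz ¬Yz
    Y∩U∩[Y⇒Z]⊆Z∩U z ((Yz , z∈o) , inj₂ Zz) = Zz , z∈o

  e-∪ : (τ σ : Topology X) {x : X} → e τ σ Y W x → e τ σ Z W x →
        e τ σ (λ z → Y z ⊎ Z z) W x
  e-∪ τ σ {x} eYW eZW o dY∪Zo =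
    [ eYW o , eZW o ] (d-∪ τ x (d-mono τ distrib x dY∪Zo))
    where
    distrib : (λ z → (Y z ⊎ Z z) × ⟨ σ ⟩ o z) ⊆
              (λ z → (Y z × ⟨ σ ⟩ o z) ⊎ (Z z × ⟨ σ ⟩ o z))
    distrib z (inj₁ Yz , z∈o) = inj₁ (Yz , z∈o)
    distrib z (inj₂ Zz , z∈o) = inj₂ (Zz , z∈o)

proposition3p4 : ExcludedMiddle 0ℓ → (B : BiTop) →
    Valid B J1 × Valid B J2 × Valid B J3 × Valid B J4
proposition3p4 em B =
    (λ ρ x → →⇒¬⊎ (cd⇒e t0 t1))
  , (λ ρ x → →⇒¬⊎ λ (pq , qr) → e-trans t0 t1 pq qr)
  , (λ ρ x → →⇒¬⊎ λ (pr , qr) → e-∪ t0 t1 pr qr)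
  , (λ ρ x → →⇒¬⊎ λ pq → →⇒¬⊎ (e⇒d⇒d t0 t1 pq))
  where
  open Classical em
  t0 = τ⁰ B
  t1 = τ¹ B
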